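{- For every monitor $m\in Mon_F$ and every $s\in Act^*$: if $m\xRightarrow{s}\mathit{yes}$ then $\mathcal{E}_v\vdash m=m+s.\mathit{yes}$, and if $m\xRightarrow{s}\mathit{no}$ then $\mathcal{E}_v\vdash m=m+s.\mathit{no}$.
   Context: Fix a set $Act$ of visible actions, a symbol $\tau\notin Act$, and a countably infinite set $Var$ of variables. Monitors $Mon_F$: $m,n ::= v \mid a.m \mid m+n \mid x$ ($a\in Act$, $x\in Var$), verdicts $v ::= \mathit{end}\mid \mathit{yes}\mid \mathit{no}$. For $s=a_1\cdots a_k$, $s.m$ denotes $a_1.a_2.\cdots a_k.m$ (and $\varepsilon.m=m$). Transitions: for $\alpha\in Act\cup\{\tau\}$, $\xrightarrow{\alpha}$ is the least relation with $a.m\xrightarrow{a}m$; if $m\xrightarrow{\alpha}m'$ then $m+n\xrightarrow{\alpha}m'$ and $n+m\xrightarrow{\alpha}m'$; and $v\xrightarrow{\alpha}v$ for every verdict $v$ and every $\alpha$. Weak transitions: $m\xRightarrow{\varepsilon}m'$ iff $m(\xrightarrow{\tau})^*m'$; $m\xRightarrow{a}m'$ iff $m\xRightarrow{\varepsilon}m_1\xrightarrow{a}m_2\xRightarrow{\varepsilon}m'$; $m\xRightarrow{as'}m'$ ($s'\neq\varepsilon$) iff $m\xRightarrow{a}m_1\xRightarrow{s'}m'$. $\mathcal{E}\vdash m=n$: derivability by reflexivity, symmetry, transitivity, substitutivity and congruence for $a.\_$ and $+$. $\mathcal{E}_v$: (A1) $x+y=y+x$; (A2) $x+(y+z)=(x+y)+z$;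 (A3) $x+x=x$; (A4) $x+\mathit{end}=x$; for each $a\in Act$: $(E_a)$ $a.\mathit{end}=\mathit{end}$; $(Y_a)$ $\mathit{yes}=\mathit{yes}+a.\mathit{yes}$; $(N_a)$ $\mathit{no}=\mathit{no}+a.\mathit{no}$; $(D_a)$ $a.(x+y)=a.x+a.y$. -}

module Defs where

open import Data.Nat using (ℕ)
open import Data.List using (List; []; _∷_)
open import Data.Maybe using (Maybe; just; nothing)

Var : Set
Var = ℕ

module Monitors (Act : Set) where

  data Verdict : Set where
    end yes no : Verdict

  data Mon : Set where
    verd : Verdict → Mon
    _·_  : Act → Mon → Mon
    _⊕_  : Mon → Mon → Mon
    var  : Var → Mon

  infixr 6 _·_
  infixl 5 _⊕_

  Label : Set
  Label = Maybe Act

  τ : Label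
  τ = nothing

  prefix : List Act → Mon → Mon
  prefix []      m = m
  prefix (a ∷ s) m = a · prefix s m

  data _—[_]→_ : Mon → Label → Mon → Set where
    act  : ∀ {a m} → (a · m) —[ just a ]→ m
    sumL : ∀ {m n α m'} → m —[ α ]→ m' → (m ⊕ n) —[ α ]→ m'
    sumR : ∀ {m n α m'} → m —[ α ]→ m' → (n ⊕ m) —[ α ]→ m'
    verdict : ∀ {v α} → verd v —[ α ]→ verd v

  data _⇒ε_ : Mon → Mon → Set where
    ε-refl : ∀ {m} → m ⇒ε m
    ε-step : ∀ {m m₁ m'} → m —[ τ ]→ m₁ → m₁ ⇒ε m' → m ⇒ε m'

  data _⇒[_]_ : Mon → List Act → Mon → Set where
    w-nil  : ∀ {m m'} → m ⇒ε m' → m ⇒[ [] ] m'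
    w-cons : ∀ {m m₁ m₂ m₃ m' a s} →
             m ⇒ε m₁ → m₁ —[ just a ]→ m₂ → m₂ ⇒ε m₃ →
             m₃ ⇒[ s ] m' → m ⇒[ a ∷ s ] m'

  Subst : Set
  Subst = Var → Mon

  _[_] : Mon → Subst → Mon
  verd v  [ σ ] = verd v
  (a · m) [ σ ] = a · (m [ σ ])
  (m ⊕ n) [ σ ] = (m [ σ ]) ⊕ (n [ σ ])
  var x   [ σ ] = σ x

  x₀ y₀ z₀ : Mon
  x₀ = var 0
  y₀ = var 1
  z₀ = var 2

  data Axiom : Mon → Mon → Set where
    A1 : Axiom (x₀ ⊕ y₀) (y₀ ⊕ x₀)
    A2 : Axiom (x₀ ⊕ (y₀ ⊕ z₀)) ((x₀ ⊕ y₀) ⊕ z₀)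
    A3 : Axiom (x₀ ⊕ x₀) x₀
    A4 : Axiom (x₀ ⊕ verd end) x₀
    Ea : ∀ a → Axiom (a · verd end) (verd end)
    Ya : ∀ a → Axiom (verd yes) (verd yes ⊕ a · verd yes)
    Na : ∀ a → Axiom (verd no) (verd no ⊕ a · verd no)
    Da : ∀ a → Axiom (a · (x₀ ⊕ y₀)) (a · x₀ ⊕ a · y₀)

  data Ev⊢_==_ : Mon → Mon → Set where
    ax    : ∀ {l r} → Axiom l r → Ev⊢ l == r
    subst' : ∀ {m n} → Ev⊢ m == n → (σ : Subst) → Ev⊢ (m [ σ ]) == (n [ σ ])
    refl' : ∀ {m} → Ev⊢ m == m
    sym'  : ∀ {m n} → Ev⊢ m == n → Ev⊢ n == m
    trans' : ∀ {m n o} → Ev⊢ m == n → Ev⊢ n == o → Ev⊢ m == o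
    cong· : ∀ {a m n} → Ev⊢ m == n → Ev⊢ (a · m) == (a · n)
    cong⊕ : ∀ {m m' n n'} → Ev⊢ m == m' → Ev⊢ n == n' → Ev⊢ (m ⊕ n) == (m' ⊕ n')

-- Write "m absorbs t" for E_v ⊢ m = m + t. Absorption propagates backwards along
-- transitions: if m —α→ m' and m' absorbs t, then m absorbs α.t (and t itself when
-- α = τ). For a prefix a.m' this is distributivity (D_a); for a sum it is
-- associativity and commutativity; for a verdict v looping on a it is the axiom
-- v = v + a.v, which holds for yes and no by (Y_a), (N_a) and for end by (E_a), (A4).
-- Iterating along a weak trace s ending in a verdict v, which absorbs itself by (A3),
-- shows that m absorbs s.v.
module Submission where

open import Defs
open import Data.List using (List)
open import Data.Product using (_×_; _,_)
open import Data.Maybe using (just; nothing)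
open import Relation.Binary.Bundles using (Setoid)
import Relation.Binary.Reasoning.Setoid as SetoidReasoning

module Absorption (Act : Set) where
  open Monitors Act

  Ev-setoid : Setoid _ _
  Ev-setoid = record
    { Carrier       = Mon
    ; _≈_           = Ev⊢_==_
    ; isEquivalence = record { refl = refl' ; sym = sym' ; trans = trans' }
    }

  open SetoidReasoning Ev-setoid

  ⟨_,_,_⟩ : Mon → Mon → Mon → Subst
  ⟨ p , q , r ⟩ 0 = p
  ⟨ p , q , r ⟩ 1 = q
  ⟨ p , q , r ⟩ _ = r

  ⊕-comm : ∀ p q → Ev⊢ (p ⊕ q) == (q ⊕ p)
  ⊕-comm p q = subst' (ax A1) ⟨ p , q , p ⟩

  ⊕-assoc : ∀ p q r → Ev⊢ (p ⊕ (q ⊕ r)) == ((p ⊕ q) ⊕ r)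
  ⊕-assoc p q r = subst' (ax A2) ⟨ p , q , r ⟩

  ⊕-idem : ∀ p → Ev⊢ (p ⊕ p) == p
  ⊕-idem p = subst' (ax A3) ⟨ p , p , p ⟩

  ⊕-identityʳ : ∀ p → Ev⊢ (p ⊕ verd end) == p
  ⊕-identityʳ p = subst' (ax A4) ⟨ p , p , p ⟩

  ·-distrib-⊕ : ∀ a p q → Ev⊢ (a · (p ⊕ q)) == (a · p ⊕ a · q)
  ·-distrib-⊕ a p q = subst' (ax (Da a)) ⟨ p , q , p ⟩

  verd-absorbs-· : ∀ v a → Ev⊢ verd v == (verd v ⊕ a · verd v)
  verd-absorbs-· end a = begin
    verd end                  ≈⟨ sym' (⊕-identityʳ (verd end)) ⟩
    verd end ⊕ verd end       ≈⟨ cong⊕ refl' (sym' (ax (Ea a))) ⟩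
    verd end ⊕ a · verd end   ∎
  verd-absorbs-· yes a = ax (Ya a)
  verd-absorbs-· no  a = ax (Na a)

  _absorbs_ : Mon → Mon → Set
  m absorbs t = Ev⊢ m == (m ⊕ t)

  infixr 6 _▸_

  _▸_ : Label → Mon → Mon
  nothing ▸ t = t
  just a  ▸ t = a · t

  absorbs-step : ∀ {m α m'} t → m —[ α ]→ m' → m' absorbs t → m absorbs (α ▸ t)
  absorbs-step {α = just a} t (act {m = m'}) h = begin
    a · m'            ≈⟨ cong· h ⟩
    a · (m' ⊕ t)      ≈⟨ ·-distrib-⊕ a m' t ⟩
    a · m' ⊕ a · t    ∎
  absorbs-step {α = α} t (sumL {m = m} {n = n} tr) h = begin
    m ⊕ n                   ≈⟨ cong⊕ (absorbs-step t tr h) refl' ⟩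
    (m ⊕ α ▸ t) ⊕ n         ≈⟨ sym' (⊕-assoc m (α ▸ t) n) ⟩
    m ⊕ (α ▸ t ⊕ n)         ≈⟨ cong⊕ refl' (⊕-comm (α ▸ t) n) ⟩
    m ⊕ (n ⊕ α ▸ t)         ≈⟨ ⊕-assoc m n (α ▸ t) ⟩
    (m ⊕ n) ⊕ α ▸ t         ∎
  absorbs-step {α = α} t (sumR {m = m} {n = n} tr) h = begin
    n ⊕ m                   ≈⟨ cong⊕ refl' (absorbs-step t tr h) ⟩
    n ⊕ (m ⊕ α ▸ t)         ≈⟨ ⊕-assoc n m (α ▸ t) ⟩
    (n ⊕ m) ⊕ α ▸ t         ∎
  absorbs-step {α = nothing} t verdict h = h
  absorbs-step {α = just a} t (verdict {v = v}) h = begin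
    verd v                              ≈⟨ verd-absorbs-· v a ⟩
    verd v ⊕ a · verd v                 ≈⟨ cong⊕ refl' (cong· h) ⟩
    verd v ⊕ a · (verd v ⊕ t)           ≈⟨ cong⊕ refl' (·-distrib-⊕ a (verd v) t) ⟩
    verd v ⊕ (a · verd v ⊕ a · t)       ≈⟨ ⊕-assoc (verd v) (a · verd v) (a · t) ⟩
    (verd v ⊕ a · verd v) ⊕ a · t       ≈⟨ cong⊕ (sym' (verd-absorbs-· v a)) refl' ⟩
    verd v ⊕ a · t                      ∎

  absorbs-⇒ε : ∀ {m m'} t → m ⇒ε m' → m' absorbs t → m absorbs t
  absorbs-⇒ε t ε-refl         h = h
  absorbs-⇒ε t (ε-step tr r) h = absorbs-step t tr (absorbs-⇒ε t r h)

  absorbs-⇒ : ∀ {m s m'} t → m ⇒[ s ] m' → m' absorbs t → m absorbs prefix s t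
  absorbs-⇒ t (w-nil r) h = absorbs-⇒ε t r h
  absorbs-⇒ t (w-cons r₁ tr r₂ rest) h =
    absorbs-⇒ε _ r₁ (absorbs-step _ tr (absorbs-⇒ε _ r₂ (absorbs-⇒ t rest h)))

  absorbs-trace-to-verd : ∀ {m s v} → m ⇒[ s ] verd v → m absorbs prefix s (verd v)
  absorbs-trace-to-verd {v = v} tr = absorbs-⇒ (verd v) tr (sym' (⊕-idem (verd v)))

lemma14 : (Act : Set) → let open Monitors Act in
    (m : Mon) (s : List Act) →
    (m ⇒[ s ] verd yes → Ev⊢ m == (m ⊕ prefix s (verd yes))) ×
    (m ⇒[ s ] verd no → Ev⊢ m == (m ⊕ prefix s (verd no)))
lemma14 Act m s = absorbs-trace-to-verd , absorbs-trace-to-verd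
  where open Absorption Act
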